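{- Let $k\geq 1$ and $N\geq 1$ be integers and let $P_N$ be the path on $N$ vertices (with loops), where the target moves at most $k$ steps after each test. Then the minimum $s$ such that there exists a $(P_N,s)$-successful (adaptive) strategy is $$s^*(P_N)=\begin{cases} N & \text{if } N\leq 2k+1,\\ \lceil N/2\rceil+k & \text{if } 2k+1<N<4k+1,\\ 3k+1 & \text{if } N\geq 4k+1.\end{cases}$$
   Context: Search model: $G$ is a finite graph on vertex set $\{1,\dots,N\}$ with a loop at every vertex. For $\mathcal A\subseteq\{1,\dots,N\}$, $\Gamma_k(\mathcal A)$ is the set of vertices $j$ such that for some $i\in\mathcal A$ there is a path (walk) from $i$ to $j$ in $G$ of length at most $k$. An unknown target occupies a vertex; a searcher performs tests $\mathcal T_1,\dots,\mathcal T_n\subseteq\{1,\dots,N\}$ one after another; test $i$ returns $y_i=1$ if the target currently lies in $\mathcal T_i$ and $y_i=0$ otherwise; after each test the target moves along a walk of length at most $k$. In an (adaptive) strategy, $\mathcal T_i$ may depend on $y_1,\dots,y_{i-1}$. The sets of possible positions are $\mathcal D_0=\{1,\dots,N\}$ and $\mathcal D_i=\Gamma_k(\mathcal T_i\cap\mathcal D_{i-1})$ if $y_i=1$, $\mathcal D_i=\Gamma_k(\mathcal D_{i-1}\setminus\mathcal T_i)$ if $y_i=0$. A strategy with $n$ tests is $(G,s)$-successful if for every sequence of test results, $|\mathcal D_i|\leq s$ for some $i\in\{0,\dots,n\}$; $s^*(G)$ is the minimum $s$ for which a $(G,s)$-successful strategy with some number of tests exists. The path $P_N$ has vertex set $\{1,\dots,N\}$,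 edges $\{i-1,i\}$ for $2\leq i\leq N$, and a loop at every vertex. -}

module Defs where

open import Data.Nat using (ℕ; zero; suc; _≤_)
open import Data.Bool using (Bool; true; false; _∧_; _∨_)
open import Data.Fin using (Fin; toℕ)
open import Data.Fin.Subset using (Subset; _∩_; _∪_; _─_; ⊤; ⊥; ∣_∣)
open import Data.List using (List; map; foldr; allFin; upTo)
open import Data.Vec using (tabulate; lookup)
open import Data.Product using (∃)
open import Relation.Nullary.Decidable using (⌊_⌋)
import Data.Nat as ℕ
open import Data.Sum using (_⊎_)
open import Data.Product using (_×_)
open import Relation.Nullary using (yes; no)

-- A graph on the vertex set Fin N (vertex i of Fin N is vertex i+1 of the
-- paper), given by its (Boolean) adjacency relation; "adj i j = true" means
-- there is an edge {i,j}.
Graph : ℕ → Set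
Graph N = Fin N → Fin N → Bool

path : (N : ℕ) → Graph N
path N i j = ⌊ toℕ i ℕ.≟ toℕ j ⌋ ∨ (⌊ suc (toℕ i) ℕ.≟ toℕ j ⌋ ∨ ⌊ toℕ i ℕ.≟ suc (toℕ j) ⌋)

step : {N : ℕ} → Graph N → Subset N → Subset N
step {N} G A = tabulate λ j → foldr _∨_ false (map (λ i → lookup A i ∧ G i j) (allFin N))

walkReach : {N : ℕ} → Graph N → ℕ → Subset N → Subset N
walkReach G zero    A = A
walkReach G (suc m) A = step G (walkReach G m A)

Γ : {N : ℕ} → Graph N → ℕ → Subset N → Subset N
Γ G k A = foldr _∪_ ⊥ (map (λ m → walkReach G m A) (upTo (suc k)))

-- An adaptive strategy with exactly n tests: a binary decision tree of
-- depth n; each node holds the test set and the continuations for the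
-- answers y = 1 (first) and y = 0 (second).
data Strategy (N : ℕ) : ℕ → Set where
  done : Strategy N zero
  test : {n : ℕ} → Subset N → Strategy N n → Strategy N n → Strategy N (suc n)

-- Successful G k s σ D : starting with possible-position set D, for every
-- sequence of test results some D_i (including the current one) has size ≤ s.
Successful : {N : ℕ} → Graph N → ℕ → ℕ → {n : ℕ} → Strategy N n → Subset N → Set
Successful G k s done D = ∣ D ∣ ≤ s
Successful G k s (test T σ₁ σ₀) D =
  ∣ D ∣ ≤ s ⊎ (Successful G k s σ₁ (Γ G k (T ∩ D)) × Successful G k s σ₀ (Γ G k (D ─ T)))

GSuccessful : {N : ℕ} → Graph N → ℕ → ℕ → {n : ℕ} → Strategy N n → Set
GSuccessful G k s σ = Successful G k s σ ⊤

Attainable : {N : ℕ} → Graph N → ℕ → ℕ → Set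
Attainable {N} G k s = ∃ λ n → ∃ λ (σ : Strategy N n) → GSuccessful G k s σ

IsSStar : {N : ℕ} → Graph N → ℕ → ℕ → Set
IsSStar G k m = Attainable G k m × (∀ s → Attainable G k s → m ≤ s)

sStarFormula : ℕ → ℕ → ℕ
sStarFormula k N with N ℕ.≤? 2 ℕ.* k ℕ.+ 1 | 4 ℕ.* k ℕ.+ 1 ℕ.≤? N
... | yes _ | _     = N
... | no _  | no _  = ℕ.⌈ N /2⌉ ℕ.+ k
... | no _  | yes _ = 3 ℕ.* k ℕ.+ 1

-- Without any test s = N.  One test "is the target in the upper half?"
-- leaves at most ⌈N/2⌉ + k candidates on either answer.  For s = 3k + 1 the tests
-- "is the target at a position ≥ 2k + e?" for e = N, N - 1, …, 1 shrink the range
-- [0, 3k + 1 + e) of possible positions by one on a negative answer, while a positive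
-- answer confines the target to a window of width 3k + 1.
--
-- Suppose D contains a block of m consecutive vertices which holds three
-- vertices x ≤ y ≤ z with z - x ≤ 2k + 1 such that the k-neighbourhoods of {x, y} and
-- of {y, z} (hence also of {x, z}) contain a block of m consecutive vertices.  Any test
-- puts two of x, y, z on the same side, so that successor set contains such a block again.
-- Such triples exist in every block of length m = N, ⌈N/2⌉ + k, 3k + 1 in the three
-- ranges of N, so every candidate set along every branch has at least m elements.

module Submission where

open import Defs
open import Data.Bool using (Bool; T; _∧_)
open import Data.Bool.Properties using (T-≡; T-∧; T-∨)
open import Data.Fin using (Fin; toℕ; fromℕ<) renaming (zero to fzero; suc to fsuc)
open import Data.Fin.Properties using (toℕ<n; toℕ-fromℕ<; toℕ-injective)
open import Data.Fin.Subset using (Subset; _∈_; _∉_; _∩_; _─_; ⋃; ⊤; ∣_∣; inside; outside)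
open import Data.Fin.Subset.Properties
  using ( x∈p∩q⁺; x∈p∩q⁻; x∈p∪q⁺; x∈p∪q⁻; x∈p∧x∉q⇒x∈p─q; p─q⊆p; ∉⊥; ∈⊤; ∣⊤∣≡n; _∈?_
        ; drop-there; ∣p∣≤∣x∷p∣)
open import Data.List using (List; []; _∷_; map; upTo; allFin)
open import Data.List.Membership.Propositional using (find; lose)
open import Data.List.Membership.Propositional.Properties using (∈-allFin; ∈-upTo⁺; ∈-upTo⁻)
open import Data.List.Relation.Unary.Any as Any using (Any; satisfied)
open import Data.List.Relation.Unary.Any.Properties using (any⁺; any⁻; map⁺; map⁻)
open import Data.Nat
open import Data.Nat.Properties
open import Data.Product using (∃; _×_; _,_; proj₁; proj₂)
open import Data.Sum using (_⊎_; inj₁; inj₂; [_,_]′)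
import Data.Sum as Sum
open import Data.Vec using (tabulate; lookup; here; there) renaming (_∷_ to _∷ᵛ_; [] to []ᵛ)
open import Data.Vec.Properties using (lookup∘tabulate; []=⇒lookup; lookup⇒[]=)
open import Data.Nat.Tactic.RingSolver using (solve)
open import Function using (_∘_; Equivalence)
open import Relation.Nullary using (yes; no; contradiction)
open import Relation.Nullary.Decidable using (⌊_⌋; toWitness; fromWitness)
open import Relation.Binary.PropositionalEquality
open import Relation.Binary.Definitions using (tri<; tri≈; tri>)

open Equivalence using (to; from)

private
  variable
    n N k m : ℕ
    i j : Fin n
    A D : Subset n

-- Subsets of vertices

∈⇒T-lookup : i ∈ A → T (lookup A i)
∈⇒T-lookup i∈A = from T-≡ ([]=⇒lookup i∈A)

T-lookup⇒∈ : T (lookup A i) → i ∈ A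
T-lookup⇒∈ t = lookup⇒[]= _ _ (to T-≡ t)

∈-tabulate⁻ : {f : Fin n → Bool} → i ∈ tabulate f → T (f i)
∈-tabulate⁻ {i = i} {f} i∈ = subst T (lookup∘tabulate f i) (∈⇒T-lookup i∈)

∈-tabulate⁺ : {f : Fin n → Bool} → T (f i) → i ∈ tabulate f
∈-tabulate⁺ {i = i} {f} t = T-lookup⇒∈ (subst T (sym (lookup∘tabulate f i)) t)

∈-─⁻ : (p q : Subset n) → i ∈ p ─ q → i ∈ p × i ∉ q
∈-─⁻ p q i∈ = p─q⊆p p q i∈ , ∉-─ p q i∈
  where
  ∉-─ : (p q : Subset n) → i ∈ p ─ q → i ∉ q
  ∉-─ (_ ∷ᵛ p) (outside ∷ᵛ q) here       ()
  ∉-─ (_ ∷ᵛ p) (_ ∷ᵛ q)       (there i∈) (there i∈q) = ∉-─ p q i∈ i∈q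

∈-⋃⁻ : (ps : List (Subset n)) → i ∈ ⋃ ps → Any (i ∈_) ps
∈-⋃⁻ []       i∈ = contradiction i∈ ∉⊥
∈-⋃⁻ (p ∷ ps) i∈ = [ Any.here , Any.there ∘ ∈-⋃⁻ ps ]′ (x∈p∪q⁻ p (⋃ ps) i∈)

∈-⋃⁺ : {ps : List (Subset n)} → Any (i ∈_) ps → i ∈ ⋃ ps
∈-⋃⁺ (Any.here i∈p)   = x∈p∪q⁺ (inj₁ i∈p)
∈-⋃⁺ (Any.there i∈ps) = x∈p∪q⁺ (inj₂ (∈-⋃⁺ i∈ps))

module _ {G : Graph N} where

  ∈-step⁻ : j ∈ step G A → ∃ λ i → i ∈ A × T (G i j)
  ∈-step⁻ {j = j} {A = A} j∈ =
    let i , t = satisfied (any⁻ (λ i → lookup A i ∧ G i j) (allFin _) (∈-tabulate⁻ j∈))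
        tA , tG = to T-∧ t
    in i , T-lookup⇒∈ tA , tG

  ∈-step⁺ : i ∈ A → T (G i j) → j ∈ step G A
  ∈-step⁺ {i = i} {A = A} {j = j} i∈ tG =
    ∈-tabulate⁺ (any⁺ (λ i → lookup A i ∧ G i j) (lose (∈-allFin i) (from T-∧ (∈⇒T-lookup i∈ , tG))))

  ∈-Γ⁻ : j ∈ Γ G k A → ∃ λ m → m ≤ k × j ∈ walkReach G m A
  ∈-Γ⁻ {k = k} {A = A} j∈ =
    let m , m∈ , j∈m = find (map⁻ (∈-⋃⁻ (map (λ m → walkReach G m A) (upTo (suc k))) j∈))
    in m , ≤-pred (∈-upTo⁻ m∈) , j∈m

  ∈-Γ⁺ : m ≤ k → j ∈ walkReach G m A → j ∈ Γ G k A
  ∈-Γ⁺ m≤k j∈ = ∈-⋃⁺ (map⁺ (lose (∈-upTo⁺ (s≤s m≤k)) j∈))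

-- Neighbourhoods in the path

Near : ℕ → ℕ → ℕ → Set
Near k a b = a ≤ b + k × b ≤ a + k

near-refl : ∀ k a → Near k a a
near-refl k a = m≤m+n a k , m≤m+n a k

near-sym : ∀ {a b} → Near k a b → Near k b a
near-sym (a≤b+k , b≤a+k) = b≤a+k , a≤b+k

near-mono : ∀ {a b} → m ≤ n → Near m a b → Near n a b
near-mono {a = a} {b} m≤n (a≤b+m , b≤a+m) =
  ≤-trans a≤b+m (+-monoʳ-≤ b m≤n) , ≤-trans b≤a+m (+-monoʳ-≤ a m≤n)

near-zero : ∀ {a b} → Near 0 a b → a ≡ b
near-zero {a} {b} (a≤b+0 , b≤a+0) =
  ≤-antisym (subst (a ≤_) (+-identityʳ b) a≤b+0) (subst (b ≤_) (+-identityʳ a) b≤a+0)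

near-step : ∀ {a b c} → Near m a b → Near 1 b c → Near (suc m) a c
near-step {m} {a} {b} {c} (a≤b+m , b≤a+m) (b≤c+1 , c≤b+1) = a≤c+1+m , c≤a+1+m
  where
  open ≤-Reasoning
  a≤c+1+m : a ≤ c + suc m
  a≤c+1+m = begin
    a           ≤⟨ a≤b+m ⟩
    b + m       ≤⟨ +-monoˡ-≤ m b≤c+1 ⟩
    c + 1 + m   ≡⟨ +-assoc c 1 m ⟩
    c + suc m   ∎
  c≤a+1+m : c ≤ a + suc m
  c≤a+1+m = begin
    c           ≤⟨ c≤b+1 ⟩
    b + 1       ≤⟨ +-monoˡ-≤ 1 b≤a+m ⟩
    a + m + 1   ≡⟨ trans (+-assoc a m 1) (cong (a +_) (+-comm m 1)) ⟩
    a + suc m   ∎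

near-one⇒adjacent : ∀ {a b} → Near 1 a b → a ≡ b ⊎ suc a ≡ b ⊎ a ≡ suc b
near-one⇒adjacent {a} {b} (a≤b+1 , b≤a+1) with <-cmp a b
... | tri< a<b _ _ = inj₂ (inj₁ (≤-antisym a<b (subst (b ≤_) (+-comm a 1) b≤a+1)))
... | tri≈ _ a≡b _ = inj₁ a≡b
... | tri> _ _ b<a = inj₂ (inj₂ (≤-antisym (subst (a ≤_) (+-comm b 1) a≤b+1) b<a))

adjacent⇒near-one : ∀ {a b} → a ≡ b ⊎ suc a ≡ b ⊎ a ≡ suc b → Near 1 a b
adjacent⇒near-one {a} (inj₁ refl)        = near-refl 1 a
adjacent⇒near-one {a} (inj₂ (inj₁ refl)) = m≤n⇒m≤1+n (m≤m+n a 1) , ≤-reflexive (+-comm 1 a)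
adjacent⇒near-one {b = b} (inj₂ (inj₂ refl)) = near-sym (m≤n⇒m≤1+n (m≤m+n b 1) , ≤-reflexive (+-comm 1 b))

path-adjacent⁻ : (i j : Fin N) → T (path N i j) → Near 1 (toℕ i) (toℕ j)
path-adjacent⁻ i j t = adjacent⇒near-one (Sum.map same (Sum.map right left ∘ to T-∨) (to T-∨ t))
  where
  same  = toWitness {a? = toℕ i ≟ toℕ j}
  right = toWitness {a? = suc (toℕ i) ≟ toℕ j}
  left  = toWitness {a? = toℕ i ≟ suc (toℕ j)}

path-adjacent⁺ : (i j : Fin N) → Near 1 (toℕ i) (toℕ j) → T (path N i j)
path-adjacent⁺ i j near = from T-∨ (Sum.map same (from T-∨ ∘ Sum.map right left) (near-one⇒adjacent near))
  where
  same  = fromWitness {a? = toℕ i ≟ toℕ j}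
  right = fromWitness {a? = suc (toℕ i) ≟ toℕ j}
  left  = fromWitness {a? = toℕ i ≟ suc (toℕ j)}

-- The vertex next to b on the way to a; the bound keeps it inside the path.
near-split : ∀ {a b} → Near (suc m) a b → ∃ λ c → Near m a c × Near 1 c b × (c ≤ a ⊎ c ≤ b)
near-split {m} {a} {b} (a≤b+1+m , b≤a+1+m) with b ≤? a + m | a ≤? b + m
... | yes b≤a+m | yes a≤b+m = b , (a≤b+m , b≤a+m) , near-refl 1 b , inj₂ ≤-refl
... | no b≰a+m  | _         =
  a + m , (≤-trans (m≤m+n a m) (m≤m+n (a + m) m) , ≤-refl) ,
  adjacent⇒near-one (inj₂ (inj₁ (≤-antisym (≰⇒> b≰a+m) (subst (b ≤_) (+-suc a m) b≤a+1+m)))) ,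
  inj₂ (<⇒≤ (≰⇒> b≰a+m))
... | yes _     | no a≰b+m  =
  suc b , (subst (a ≤_) (+-suc b m) a≤b+1+m , ≤-trans sb≤a (m≤m+n a m)) ,
  adjacent⇒near-one (inj₂ (inj₂ refl)) , inj₁ sb≤a
  where
  sb≤a : suc b ≤ a
  sb≤a = ≤-trans (s≤s (m≤m+n b m)) (≰⇒> a≰b+m)

near-split-fin : {i j : Fin n} → Near (suc m) (toℕ i) (toℕ j) →
                 ∃ λ (h : Fin n) → Near m (toℕ i) (toℕ h) × Near 1 (toℕ h) (toℕ j)
near-split-fin {m = m} {i = i} {j = j} near with near-split near
... | c , near-ic , near-cj , c≤ =
  fromℕ< c<n ,
  subst (Near m (toℕ i)) (sym c≡) near-ic ,
  subst (λ x → Near 1 x (toℕ j)) (sym c≡) near-cj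
  where
  c<n = [ (λ c≤i → ≤-<-trans c≤i (toℕ<n i)) , (λ c≤j → ≤-<-trans c≤j (toℕ<n j)) ]′ c≤
  c≡ = toℕ-fromℕ< c<n

∈-walkReach-path⁻ : ∀ m → j ∈ walkReach (path N) m A → ∃ λ i → i ∈ A × Near m (toℕ i) (toℕ j)
∈-walkReach-path⁻ zero    j∈ = _ , j∈ , near-refl 0 _
∈-walkReach-path⁻ (suc m) j∈ =
  let h , h∈ , adj     = ∈-step⁻ j∈
      i , i∈ , near-ih = ∈-walkReach-path⁻ m h∈
  in i , i∈ , near-step near-ih (path-adjacent⁻ h _ adj)

∈-walkReach-path⁺ : ∀ m → i ∈ A → Near m (toℕ i) (toℕ j) → j ∈ walkReach (path N) m A
∈-walkReach-path⁺ zero    i∈ near = subst (_∈ _) (toℕ-injective (near-zero near)) i∈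
∈-walkReach-path⁺ (suc m) i∈ near =
  let h , near-ih , near-hj = near-split-fin near
  in ∈-step⁺ (∈-walkReach-path⁺ m i∈ near-ih) (path-adjacent⁺ h _ near-hj)

∈-Γ-path⁻ : j ∈ Γ (path N) k A → ∃ λ i → i ∈ A × Near k (toℕ i) (toℕ j)
∈-Γ-path⁻ j∈ =
  let m , m≤k , j∈m  = ∈-Γ⁻ j∈
      i , i∈ , near = ∈-walkReach-path⁻ m j∈m
  in i , i∈ , near-mono m≤k near

∈-Γ-path⁺ : i ∈ A → Near k (toℕ i) (toℕ j) → j ∈ Γ (path N) k A
∈-Γ-path⁺ {k = k} i∈ near = ∈-Γ⁺ {G = path _} {k = k} ≤-refl (∈-walkReach-path⁺ k i∈ near)

-- Upper bounds

∣∣≤-width : (D : Subset n) (lo w : ℕ) → (∀ {j} → j ∈ D → lo ≤ toℕ j × toℕ j < lo + w) → ∣ D ∣ ≤ w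
∣∣≤-width []ᵛ             lo       w       _     = z≤n
∣∣≤-width (inside ∷ᵛ D)   (suc lo) w       bound with () ← proj₁ (bound here)
∣∣≤-width (outside ∷ᵛ D)  (suc lo) w       bound =
  ∣∣≤-width D lo w λ j∈ → let lo≤j , j<hi = bound (there j∈) in ≤-pred lo≤j , ≤-pred j<hi
∣∣≤-width (inside ∷ᵛ D)   zero     zero    bound with () ← proj₂ (bound here)
∣∣≤-width (inside ∷ᵛ D)   zero     (suc w) bound =
  s≤s (∣∣≤-width D 0 w λ j∈ → z≤n , ≤-pred (proj₂ (bound (there j∈))))
∣∣≤-width (outside ∷ᵛ D)  zero     w       bound =
  ∣∣≤-width D 0 w λ j∈ → z≤n , ≤-trans (n≤1+n _) (proj₂ (bound (there j∈)))

width≤∣∣ : (D : Subset n) (lo w : ℕ) → lo + w ≤ n →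
           (∀ j → lo ≤ toℕ j → toℕ j < lo + w → j ∈ D) → w ≤ ∣ D ∣
width≤∣∣ D         lo       zero    _          _     = z≤n
width≤∣∣ (s ∷ᵛ D)  (suc lo) w       (s≤s fits) cover =
  ≤-trans (width≤∣∣ D lo w fits λ j lo≤j j<hi → drop-there (cover (fsuc j) (s≤s lo≤j) (s≤s j<hi)))
          (∣p∣≤∣x∷p∣ s D)
width≤∣∣ (s ∷ᵛ D)  zero     (suc w) (s≤s fits) cover with cover fzero z≤n (s≤s z≤n)
... | here = s≤s (width≤∣∣ D 0 w fits λ j _ j<w → drop-there (cover (fsuc j) z≤n (s≤s j<w)))

atLeast : ℕ → Subset n
atLeast t = tabulate λ j → ⌊ t ≤? toℕ j ⌋

∈-atLeast⁻ : ∀ {t} {j : Fin n} → j ∈ atLeast t → t ≤ toℕ j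
∈-atLeast⁻ {t = t} {j} j∈ = toWitness {a? = t ≤? toℕ j} (∈-tabulate⁻ j∈)

∉-atLeast⁻ : ∀ {t} {j : Fin n} → j ∉ atLeast t → toℕ j < t
∉-atLeast⁻ {t = t} {j} j∉ = ≰⇒> (j∉ ∘ ∈-tabulate⁺ ∘ fromWitness {a? = t ≤? toℕ j})

Γ-path-above : ∀ {lo} → (∀ {i} → i ∈ A → lo + k ≤ toℕ i) → ∀ {j} → j ∈ Γ (path N) k A → lo ≤ toℕ j
Γ-path-above {k = k} {lo = lo} bound j∈ =
  let _ , i∈ , (i≤j+k , _) = ∈-Γ-path⁻ j∈ in +-cancelʳ-≤ k lo _ (≤-trans (bound i∈) i≤j+k)

Γ-path-below : ∀ {hi} → (∀ {i} → i ∈ A → toℕ i < hi) → ∀ {j} → j ∈ Γ (path N) k A → toℕ j < hi + k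
Γ-path-below {k = k} bound j∈ =
  let _ , i∈ , (_ , j≤i+k) = ∈-Γ-path⁻ j∈ in ≤-<-trans j≤i+k (+-monoˡ-< k (bound i∈))

successful-small : ∀ {G : Graph N} {s n} (σ : Strategy N n) → ∣ D ∣ ≤ s → Successful G k s σ D
successful-small done           small = small
successful-small (test _ _ _)   small = inj₁ small

attainable-N : (G : Graph N) (k : ℕ) → Attainable G k N
attainable-N {N} G k = 0 , done , ≤-reflexive (∣⊤∣≡n N)

halving-test : ∀ k c → k ≤ c → N ≤ c + c → Attainable (path N) k (c + k)
halving-test {N} k c k≤c N≤c+c = 1 , test (atLeast c) done done , inj₂ (upper-half , lower-half)
  where
  width : c ∸ k + (c + k) ≡ c + c
  width = begin
    c ∸ k + (c + k)  ≡⟨ cong (c ∸ k +_) (+-comm c k) ⟩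
    c ∸ k + (k + c)  ≡⟨ +-assoc (c ∸ k) k c ⟨
    c ∸ k + k + c    ≡⟨ cong (_+ c) (m∸n+n≡m k≤c) ⟩
    c + c            ∎
    where open ≡-Reasoning

  upper-half : ∣ Γ (path N) k (atLeast c ∩ ⊤) ∣ ≤ c + k
  upper-half = ∣∣≤-width (Γ (path N) k (atLeast c ∩ ⊤)) (c ∸ k) (c + k) λ j∈ →
    Γ-path-above {lo = c ∸ k} above j∈ , ≤-trans (toℕ<n _) (≤-trans N≤c+c (≤-reflexive (sym width)))
    where
    above : ∀ {i} → i ∈ atLeast c ∩ ⊤ → c ∸ k + k ≤ toℕ i
    above i∈ = ≤-trans (≤-reflexive (m∸n+n≡m k≤c)) (∈-atLeast⁻ (proj₁ (x∈p∩q⁻ _ _ i∈)))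

  lower-half : ∣ Γ (path N) k (⊤ ─ atLeast c) ∣ ≤ c + k
  lower-half = ∣∣≤-width (Γ (path N) k (⊤ ─ atLeast c)) 0 (c + k) λ j∈ →
    z≤n , Γ-path-below {hi = c} (λ i∈ → ∉-atLeast⁻ (proj₂ (∈-─⁻ ⊤ _ i∈))) j∈

sweep : ∀ k e → Strategy N e
sweep k zero    = done
sweep k (suc e) = test (atLeast (k + k + suc e)) (sweep k e) (sweep k e)

sweep-successful : ∀ k e (D : Subset N) → (∀ {j} → j ∈ D → toℕ j < 3 * k + 1 + e) →
                   Successful (path N) k (3 * k + 1) (sweep k e) D
sweep-successful k zero D below =
  ∣∣≤-width D 0 (3 * k + 1) λ j∈ → z≤n , ≤-trans (below j∈) (≤-reflexive (+-identityʳ _))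
sweep-successful {N} k (suc e) D below =
  inj₂ (successful-small (sweep k e) caught , sweep-successful k e (Γ (path N) k (D ─ Tₑ)) escaped)
  where
  Tₑ = atLeast (k + k + suc e)

  caught : ∣ Γ (path N) k (Tₑ ∩ D) ∣ ≤ 3 * k + 1
  caught = ∣∣≤-width (Γ (path N) k (Tₑ ∩ D)) (k + suc e) (3 * k + 1) λ j∈ →
    Γ-path-above {lo = k + suc e} above j∈ ,
    ≤-trans (Γ-path-below {hi = 3 * k + 1 + suc e} (below ∘ proj₂ ∘ x∈p∩q⁻ Tₑ D) j∈) (≤-reflexive top)
    where
    threshold : k + suc e + k ≡ k + k + suc e
    threshold = solve (k ∷ e ∷ [])
    above : ∀ {i} → i ∈ Tₑ ∩ D → k + suc e + k ≤ toℕ i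
    above i∈ = ≤-trans (≤-reflexive threshold) (∈-atLeast⁻ (proj₁ (x∈p∩q⁻ Tₑ D i∈)))
    top : 3 * k + 1 + suc e + k ≡ k + suc e + (3 * k + 1)
    top = solve (k ∷ e ∷ [])

  escaped : ∀ {j} → j ∈ Γ (path N) k (D ─ Tₑ) → toℕ j < 3 * k + 1 + e
  escaped j∈ =
    ≤-trans (Γ-path-below {hi = k + k + suc e} (∉-atLeast⁻ ∘ proj₂ ∘ ∈-─⁻ D Tₑ) j∈) (≤-reflexive top)
    where
    top : k + k + suc e + k ≡ 3 * k + 1 + e
    top = solve (k ∷ e ∷ [])

attainable-3k+1 : ∀ k → Attainable (path N) k (3 * k + 1)
attainable-3k+1 {N} k =
  N , sweep k N , sweep-successful k N ⊤ λ {j} _ → ≤-trans (toℕ<n j) (m≤n+m N (3 * k + 1))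

-- Lower bound

Block : ℕ → Subset N → Set
Block {N} m D = ∃ λ a → a + m ≤ N × (∀ j → a ≤ toℕ j → toℕ j < a + m → j ∈ D)

block⇒≤∣∣ : Block m D → m ≤ ∣ D ∣
block⇒≤∣∣ {D = D} (a , fits , block) = width≤∣∣ D a _ fits block

At : Subset N → ℕ → Set
At D p = ∃ λ j → toℕ j ≡ p × j ∈ D

Window : ℕ → ℕ → ℕ → ℕ → ℕ → Set
Window N k m u v = ∃ λ b → b + m ≤ N × u ≤ b + k × b + m ≤ suc (v + k)

window-mono : ∀ {u v v′} → v ≤ v′ → Window N k m u v → Window N k m u v′
window-mono {k = k} v≤v′ (b , fits , u≤b+k , b+m≤v+k+1) =
  b , fits , u≤b+k , ≤-trans b+m≤v+k+1 (s≤s (+-monoˡ-≤ k v≤v′))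

-- Γ_k{u, v} covers [u - k, v + k] as soon as the two k-neighbourhoods touch.
window⇒block : ∀ {S : Subset N} {u v} → At S u → At S v → v ≤ suc (u + k + k) → Window N k m u v →
               Block m (Γ (path N) k S)
window⇒block {N} {k} {m} {S} (x , refl , x∈) (y , refl , y∈) gap (b , fits , x≤b+k , b+m≤y+k+1) =
  b , fits , cover
  where
  cover : ∀ j → b ≤ toℕ j → toℕ j < b + m → j ∈ Γ (path N) k S
  cover j b≤j j<b+m with toℕ j ≤? toℕ x + k
  ... | yes j≤x+k = ∈-Γ-path⁺ x∈ (≤-trans x≤b+k (+-monoˡ-≤ k b≤j) , j≤x+k)
  ... | no  j≰x+k = ∈-Γ-path⁺ y∈ (≤-trans gap (+-monoˡ-≤ k (≰⇒> j≰x+k)) , ≤-pred (≤-trans j<b+m b+m≤y+k+1))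

record Triple (N k m a : ℕ) : Set where
  field
    x y z     : ℕ
    a≤x       : a ≤ x
    x≤y       : x ≤ y
    y≤z       : y ≤ z
    z<a+m     : z < a + m
    z≤x+2k+1  : z ≤ suc (x + k + k)
    window-xy : Window N k m x y
    window-yz : Window N k m y z

Triples : ℕ → ℕ → ℕ → Set
Triples N k m = ∀ a → a + m ≤ N → Triple N k m a

block-survives : Triples N k m → ∀ T D → Block m D →
                 Block m (Γ (path N) k (T ∩ D)) ⊎ Block m (Γ (path N) k (D ─ T))
block-survives {N} {k} {m} triples T D (a , fits , block) = pigeonhole (split xD) (split yD) (split zD)
  where
  open Triple (triples a fits)

  at : ∀ {p} → a ≤ p → p < a + m → At D p
  at {p} a≤p p<a+m = fromℕ< p<N , p≡ , block _ (subst (a ≤_) (sym p≡) a≤p) (subst (_< a + m) (sym p≡) p<a+m)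
    where
    p<N = ≤-trans p<a+m fits
    p≡  = toℕ-fromℕ< p<N

  xD = at a≤x (≤-<-trans (≤-trans x≤y y≤z) z<a+m)
  yD = at (≤-trans a≤x x≤y) (≤-<-trans y≤z z<a+m)
  zD = at (≤-trans a≤x (≤-trans x≤y y≤z)) z<a+m

  split : ∀ {p} → At D p → At (T ∩ D) p ⊎ At (D ─ T) p
  split (j , j≡p , j∈D) with j ∈? T
  ... | yes j∈T = inj₁ (j , j≡p , x∈p∩q⁺ (j∈T , j∈D))
  ... | no  j∉T = inj₂ (j , j≡p , x∈p∧x∉q⇒x∈p─q j∈D j∉T)

  xy : ∀ {S} → At S x → At S y → Block m (Γ (path N) k S)
  xy Sx Sy = window⇒block Sx Sy (≤-trans y≤z z≤x+2k+1) window-xy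

  yz : ∀ {S} → At S y → At S z → Block m (Γ (path N) k S)
  yz Sy Sz = window⇒block Sy Sz (≤-trans z≤x+2k+1 (s≤s (+-monoˡ-≤ k (+-monoˡ-≤ k x≤y)))) window-yz

  xz : ∀ {S} → At S x → At S z → Block m (Γ (path N) k S)
  xz Sx Sz = window⇒block Sx Sz z≤x+2k+1 (window-mono y≤z window-xy)

  pigeonhole : At (T ∩ D) x ⊎ At (D ─ T) x → At (T ∩ D) y ⊎ At (D ─ T) y → At (T ∩ D) z ⊎ At (D ─ T) z →
               Block m (Γ (path N) k (T ∩ D)) ⊎ Block m (Γ (path N) k (D ─ T))
  pigeonhole (inj₁ x₁) (inj₁ y₁) _         = inj₁ (xy x₁ y₁)
  pigeonhole (inj₂ x₀) (inj₂ y₀) _         = inj₂ (xy x₀ y₀)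
  pigeonhole (inj₁ x₁) (inj₂ y₀) (inj₁ z₁) = inj₁ (xz x₁ z₁)
  pigeonhole (inj₁ x₁) (inj₂ y₀) (inj₂ z₀) = inj₂ (yz y₀ z₀)
  pigeonhole (inj₂ x₀) (inj₁ y₁) (inj₁ z₁) = inj₁ (yz y₁ z₁)
  pigeonhole (inj₂ x₀) (inj₁ y₁) (inj₂ z₀) = inj₂ (xz x₀ z₀)

block-bound : Triples N k m → ∀ {s n} (σ : Strategy N n) D → Block m D → Successful (path N) k s σ D → m ≤ s
block-bound triples done           D block small         = ≤-trans (block⇒≤∣∣ block) small
block-bound triples (test T σ₁ σ₀) D block (inj₁ small)  = ≤-trans (block⇒≤∣∣ block) small
block-bound triples (test T σ₁ σ₀) D block (inj₂ (ok₁ , ok₀)) with block-survives triples T D block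
... | inj₁ block₁ = block-bound triples σ₁ _ block₁ ok₁
... | inj₂ block₀ = block-bound triples σ₀ _ block₀ ok₀

lower-bound : m ≤ N → Triples N k m → ∀ s → Attainable (path N) k s → m ≤ s
lower-bound m≤N triples s (_ , σ , ok) = block-bound triples σ ⊤ (0 , m≤N , λ _ _ _ → ∈⊤) ok

⌈n/2⌉≤1+⌊n/2⌋ : ∀ n → ⌈ n /2⌉ ≤ suc ⌊ n /2⌋
⌈n/2⌉≤1+⌊n/2⌋ zero          = z≤n
⌈n/2⌉≤1+⌊n/2⌋ (suc zero)    = ≤-refl
⌈n/2⌉≤1+⌊n/2⌋ (suc (suc n)) = s≤s (⌈n/2⌉≤1+⌊n/2⌋ n)

2k+1≡1+[k+k] : ∀ k → 2 * k + 1 ≡ suc (k + k)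
2k+1≡1+[k+k] k = solve (k ∷ [])

⌊2k+1/2⌋≡k : ∀ k → ⌊ 2 * k + 1 /2⌋ ≡ k
⌊2k+1/2⌋≡k k rewrite 2k+1≡1+[k+k] k = sym (n≡⌈n+n/2⌉ k)

⌈2k+1/2⌉≡1+k : ∀ k → ⌈ 2 * k + 1 /2⌉ ≡ suc k
⌈2k+1/2⌉≡1+k k rewrite 2k+1≡1+[k+k] k = cong suc (sym (n≡⌊n+n/2⌋ k))

⌊4k/2⌋≡k+k : ∀ k → ⌊ 4 * k /2⌋ ≡ k + k
⌊4k/2⌋≡k+k k = trans (cong ⌊_/2⌋ 4k≡2k+2k) (sym (n≡⌊n+n/2⌋ (k + k)))
  where
  4k≡2k+2k : 4 * k ≡ (k + k) + (k + k)
  4k≡2k+2k = solve (k ∷ [])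

n≤⌈n/2⌉+⌈n/2⌉ : ∀ n → n ≤ ⌈ n /2⌉ + ⌈ n /2⌉
n≤⌈n/2⌉+⌈n/2⌉ n = ≤-trans (≤-reflexive (sym (⌊n/2⌋+⌈n/2⌉≡n n))) (+-monoˡ-≤ ⌈ n /2⌉ (⌊n/2⌋≤⌈n/2⌉ n))

⌈n/2⌉+k≤n : ∀ {n k} → k ≤ ⌊ n /2⌋ → ⌈ n /2⌉ + k ≤ n
⌈n/2⌉+k≤n {n} k≤⌊n/2⌋ =
  ≤-trans (+-monoʳ-≤ ⌈ n /2⌉ k≤⌊n/2⌋) (≤-reflexive (trans (+-comm ⌈ n /2⌉ ⌊ n /2⌋) (⌊n/2⌋+⌈n/2⌉≡n n)))

triples-short : ∀ {N k} → 1 ≤ N → N ≤ 2 * k + 1 → Triples N k N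
triples-short {suc n} {k} _ N≤2k+1 a a+N≤N = record
  { x = h ; y = h ; z = h
  ; a≤x       = ≤-trans (+-cancelʳ-≤ (suc n) a 0 a+N≤N) z≤n
  ; x≤y       = ≤-refl
  ; y≤z       = ≤-refl
  ; z<a+m     = ≤-trans (⌊n/2⌋<n n) (m≤n+m (suc n) a)
  ; z≤x+2k+1  = m≤n⇒m≤1+n (≤-trans (m≤m+n h k) (m≤m+n (h + k) k))
  ; window-xy = window
  ; window-yz = window
  }
  where
  open ≤-Reasoning
  h = ⌊ suc n /2⌋

  N≤h+k+1 : suc n ≤ suc (h + k)
  N≤h+k+1 = begin
    suc n              ≡⟨ ⌊n/2⌋+⌈n/2⌉≡n (suc n) ⟨
    h + ⌈ suc n /2⌉    ≤⟨ +-monoʳ-≤ h (⌈n/2⌉-mono N≤2k+1) ⟩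
    h + ⌈ 2 * k + 1 /2⌉ ≡⟨ cong (h +_) (⌈2k+1/2⌉≡1+k k) ⟩
    h + suc k          ≡⟨ +-suc h k ⟩
    suc (h + k)        ∎

  window : Window (suc n) k (suc n) h h
  window = 0 , ≤-refl , ≤-trans (⌊n/2⌋-mono N≤2k+1) (≤-reflexive (⌊2k+1/2⌋≡k k)) , N≤h+k+1

-- Here ⌊N/2⌋ = k + 1 + d and ⌈N/2⌉ = c.
triples-middle′ : ∀ k d c → k + suc d ≤ c → c ≤ suc (k + suc d) → suc d ≤ k →
                  Triples (k + suc d + c) k (c + k)
triples-middle′ k d c f≤c c≤1+f 1+d≤k a a+m≤N = record
  { x = k ; y = k + suc d ; z = c + d
  ; a≤x       = ≤-trans (+-cancelʳ-≤ (c + k) a (suc d) (≤-trans a+m≤N (≤-reflexive N≡))) 1+d≤k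
  ; x≤y       = m≤m+n k (suc d)
  ; y≤z       = ≤-trans f≤c (m≤m+n c d)
  ; z<a+m     = ≤-trans (≤-reflexive (sym (+-suc c d))) (≤-trans (+-monoʳ-≤ c 1+d≤k) (m≤n+m (c + k) a))
  ; z≤x+2k+1  = z≤3k+1
  ; window-xy = 0 , ≤-trans (+-monoʳ-≤ c (m≤m+n k (suc d))) (≤-reflexive (+-comm c (k + suc d))) ,
                ≤-refl , +-monoˡ-≤ k c≤1+f
  ; window-yz = suc d , ≤-reflexive (sym N≡) , ≤-reflexive (+-comm k (suc d)) , ≤-reflexive right-end
  }
  where
  N≡ : k + suc d + c ≡ suc d + (c + k)
  N≡ = solve (k ∷ d ∷ c ∷ [])

  right-end : suc d + (c + k) ≡ suc (c + d + k)
  right-end = solve (k ∷ d ∷ c ∷ [])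

  z≤3k+1 : c + d ≤ suc (k + k + k)
  z≤3k+1 = begin
    c + d                  ≤⟨ +-monoˡ-≤ d c≤1+f ⟩
    suc (k + suc d) + d    ≡⟨ solve (k ∷ d ∷ []) ⟩
    k + (suc d + suc d)    ≤⟨ +-monoʳ-≤ k (+-mono-≤ 1+d≤k 1+d≤k) ⟩
    k + (k + k)            ≡⟨ +-assoc k k k ⟨
    k + k + k              ≤⟨ n≤1+n _ ⟩
    suc (k + k + k)        ∎
    where open ≤-Reasoning

k<⌊n/2⌋ : ∀ {n k} → 2 * k + 1 < n → k < ⌊ n /2⌋
k<⌊n/2⌋ {k = k} 2k+1<n = ≤-trans (≤-reflexive (sym (⌈2k+1/2⌉≡1+k k))) (⌊n/2⌋-mono 2k+1<n)

triples-middle : ∀ {N k} → 2 * k + 1 < N → N < 4 * k + 1 → Triples N k (⌈ N /2⌉ + k)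
triples-middle {N} {k} 2k+1<N N<4k+1 with m≤n⇒∃[o]m+o≡n (k<⌊n/2⌋ 2k+1<N)
... | d , 1+k+d≡f = subst (λ n → Triples n k (⌈ N /2⌉ + k)) f+c≡N
  (triples-middle′ k d ⌈ N /2⌉ (≤-trans (≤-reflexive f≡) (⌊n/2⌋≤⌈n/2⌉ N))
                               (≤-trans (⌈n/2⌉≤1+⌊n/2⌋ N) (s≤s (≤-reflexive (sym f≡)))) 1+d≤k)
  where
  f≡ : k + suc d ≡ ⌊ N /2⌋
  f≡ = trans (+-suc k d) 1+k+d≡f

  f+c≡N : k + suc d + ⌈ N /2⌉ ≡ N
  f+c≡N = trans (cong (_+ ⌈ N /2⌉) f≡) (⌊n/2⌋+⌈n/2⌉≡n N)

  1+d≤k : suc d ≤ k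
  1+d≤k = +-cancelˡ-≤ k (suc d) k (begin
    k + suc d   ≡⟨ f≡ ⟩
    ⌊ N /2⌋     ≤⟨ ⌊n/2⌋-mono (≤-pred (≤-trans N<4k+1 (≤-reflexive (+-comm (4 * k) 1)))) ⟩
    ⌊ 4 * k /2⌋ ≡⟨ ⌊4k/2⌋≡k+k k ⟩
    k + k       ∎)
    where open ≤-Reasoning

triple-anchored : ∀ {N k a} g → a ≤ k + g → g ≤ a → k + g + (3 * k + 1) ≤ N → Triple N k (3 * k + 1) a
triple-anchored {k = k} g a≤k+g g≤a fits = record
  { x = k + g ; y = k + g + k ; z = k + g + k + k
  ; a≤x       = a≤k+g
  ; x≤y       = m≤m+n (k + g) k
  ; y≤z       = m≤m+n (k + g + k) k
  ; z<a+m     = ≤-trans (≤-reflexive left-block) (+-monoˡ-≤ (3 * k + 1) g≤a)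
  ; z≤x+2k+1  = n≤1+n _
  ; window-xy = g , ≤-trans (+-monoˡ-≤ (3 * k + 1) (m≤n+m g k)) fits ,
                ≤-reflexive (+-comm k g) , ≤-reflexive (sym left-block)
  ; window-yz = k + g , fits , ≤-refl , ≤-reflexive right-block
  }
  where
  left-block : suc (k + g + k + k) ≡ g + (3 * k + 1)
  left-block = solve (k ∷ g ∷ [])

  right-block : k + g + (3 * k + 1) ≡ suc (k + g + k + k + k)
  right-block = solve (k ∷ g ∷ [])

triples-long : ∀ {N k} → 4 * k + 1 ≤ N → Triples N k (3 * k + 1)
triples-long {k = k} 4k+1≤N a a+m≤N with ≤-total a k
... | inj₁ a≤k = triple-anchored 0 (≤-trans a≤k (m≤m+n k 0)) z≤n (≤-trans (≤-reflexive 4k+1≡) 4k+1≤N)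
  where
  4k+1≡ : k + 0 + (3 * k + 1) ≡ 4 * k + 1
  4k+1≡ = solve (k ∷ [])
... | inj₂ k≤a with m≤n⇒∃[o]m+o≡n k≤a
...   | g , refl = triple-anchored g ≤-refl (m≤n+m g k) a+m≤N

theorem2 : (k N : ℕ) → 1 ≤ k → 1 ≤ N → IsSStar (path N) k (sStarFormula k N)
theorem2 k N _ 1≤N with N ≤? 2 * k + 1 | 4 * k + 1 ≤? N
... | yes N≤2k+1 | _ =
  attainable-N (path N) k , lower-bound ≤-refl (triples-short 1≤N N≤2k+1)
... | no _ | yes 4k+1≤N =
  attainable-3k+1 k , lower-bound (≤-trans 3k+1≤4k+1 4k+1≤N) (triples-long 4k+1≤N)
  where
  3k+1≤4k+1 : 3 * k + 1 ≤ 4 * k + 1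
  3k+1≤4k+1 = +-monoˡ-≤ 1 (*-monoˡ-≤ k (n≤1+n 3))
... | no N≰2k+1 | no 4k+1≰N =
  halving-test k ⌈ N /2⌉ (≤-trans k≤⌊N/2⌋ (⌊n/2⌋≤⌈n/2⌉ N)) (n≤⌈n/2⌉+⌈n/2⌉ N) ,
  lower-bound (⌈n/2⌉+k≤n k≤⌊N/2⌋) (triples-middle (≰⇒> N≰2k+1) (≰⇒> 4k+1≰N))
  where
  k≤⌊N/2⌋ : k ≤ ⌊ N /2⌋
  k≤⌊N/2⌋ = <⇒≤ (k<⌊n/2⌋ (≰⇒> N≰2k+1))
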